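{- There exists no doubly Eulerian graph of odd order $n\geq 3$ containing a vertex of valency $n-1$.
   Context: All graphs are finite, simple and connected. An Eulerian circuit is a closed trail traversing every edge exactly once. Let $G$ be Eulerian with $m$ edges and $u$ a vertex. Two Eulerian circuits $u,v_1,\ldots,v_{m-1},u$ and $u,w_1,\ldots,w_{m-1},u$ are avoiding if for every $1\le i\le m-1$, $v_i\neq w_i$ and $v_i$ is not adjacent to $w_i$. $G$ is doubly Eulerian if it is Eulerian and for every vertex $u$ there is a pair of avoiding Eulerian circuits starting and ending at $u$. -}

module Defs where

open import Data.Nat using (ℕ; zero; suc; _*_; _≤_; _∸_)
open import Data.Fin using (Fin; zero; suc; toℕ; fromℕ; inject₁)
open import Data.List using (List; length; filter)
open import Data.List.Base using ()
open import Data.Fin.Base using ()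
open import Data.List using (List)
open import Data.Product using (Σ; ∃; _×_; _,_)
open import Data.Sum using (_⊎_)
open import Relation.Nullary using (¬_; Dec)
open import Relation.Binary.PropositionalEquality using (_≡_; _≢_)
import Data.List as L

record Graph (n : ℕ) : Set₁ where
  field
    Adj    : Fin n → Fin n → Set
    adj?   : (x y : Fin n) → Dec (Adj x y)
    sym    : ∀ {x y} → Adj x y → Adj y x
    irrefl : ∀ {x} → ¬ Adj x x
open Graph public

data Walk {n : ℕ} (G : Graph n) : Fin n → Fin n → Set where
  here : ∀ {x} → Walk G x x
  step : ∀ {x y z} → Adj G x y → Walk G y z → Walk G x z

Connected : ∀ {n} → Graph n → Set
Connected {n} G = (x y : Fin n) → Walk G x y

degree : ∀ {n} → Graph n → Fin n → ℕ
degree {n} G v = length (filter (adj? G v) (L.allFin n))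

SameEdge : ∀ {n} → Fin n → Fin n → Fin n → Fin n → Set
SameEdge a b c d = (a ≡ c × b ≡ d) ⊎ (a ≡ d × b ≡ c)

record EulerCircuit {n : ℕ} (G : Graph n) (u : Fin n) (m : ℕ) : Set where
  field
    seq    : Fin (suc m) → Fin n
    start  : seq zero ≡ u
    end    : seq (fromℕ m) ≡ u
    walk   : (i : Fin m) → Adj G (seq (inject₁ i)) (seq (suc i))
    trail  : (i j : Fin m) →
             SameEdge (seq (inject₁ i)) (seq (suc i)) (seq (inject₁ j)) (seq (suc j)) → i ≡ j
    covers : (x y : Fin n) → Adj G x y →
             ∃ λ (i : Fin m) → SameEdge (seq (inject₁ i)) (seq (suc i)) x y
open EulerCircuit public

Eulerian : ∀ {n} → Graph n → Set
Eulerian {n} G = Σ (Fin n) λ u → Σ ℕ λ m → EulerCircuit G u m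

Avoiding : ∀ {n} {G : Graph n} {u : Fin n} {m : ℕ} →
           EulerCircuit G u m → EulerCircuit G u m → Set
Avoiding {n} {G} {u} {m} C D =
  (i : Fin m) → 1 ≤ toℕ i →
    (seq C (inject₁ i) ≢ seq D (inject₁ i)) × ¬ Adj G (seq C (inject₁ i)) (seq D (inject₁ i))

DoublyEulerian : ∀ {n} → Graph n → Set
DoublyEulerian {n} G =
  Eulerian G ×
  ((u : Fin n) → Σ ℕ λ m → Σ (EulerCircuit G u m) λ C → Σ (EulerCircuit G u m) λ D → Avoiding C D)

Odd : ℕ → Set
Odd n = ∃ λ k → n ≡ suc (2 * k)

-- Let v be a universal vertex and C, D avoiding Eulerian circuits from v.
-- At an interior position C and D sit on distinct non-adjacent vertices, and
-- nothing is non-adjacent to v except v itself, so neither circuit revisits v: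
-- the only edges at v are the first and the last edge of C, and every other
-- vertex is C₁ or C_{m-1}. As D₁ ≠ C₁, this forces C_{m-1} = D₁, and then C₂,
-- which is adjacent to C₁ but neither v, C₁ nor D₁ (the latter being
-- non-adjacent to C₁), has nowhere to go. Short circuits (m ≤ 2) cannot even
-- leave v and return along distinct edges.
module Submission where

open import Defs
open import Data.Nat using (ℕ; zero; suc; _+_; _≤_; _∸_; s≤s; z≤n)
open import Data.Nat.Properties using (≤-trans; n≤1+n; 1+n≰n)
open import Data.Fin using (Fin; zero; suc; toℕ; fromℕ; inject₁; _≟_)
open import Data.Fin.Properties using (punchInᵢ≢i)
open import Data.List using (List; _∷_; filter; length)
open import Data.List.Properties using (filter-reject; filter-notAll; length-tabulate)
open import Data.List.Membership.Propositional using (_∈_)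
open import Data.List.Membership.Propositional.Properties using (∈-allFin)
open import Data.List.Relation.Unary.Any using (here; there)
import Data.List.Relation.Unary.Any as Any
open import Data.Product using (Σ-syntax; _,_; proj₁; proj₂)
open import Data.Sum using (_⊎_; inj₁; inj₂)
open import Data.Empty using (⊥; ⊥-elim)
open import Relation.Nullary using (¬_; yes; no)
open import Relation.Unary using (Decidable)
open import Relation.Binary.PropositionalEquality
  using (_≡_; _≢_; refl; trans; cong; subst; subst₂)
  renaming (sym to ≡-sym)

length-filter-reject₂ : ∀ {A : Set} {P : A → Set} (P? : Decidable P) {xs : List A} {x y : A} →
                        x ∈ xs → y ∈ xs → x ≢ y → ¬ P x → ¬ P y →
                        2 + length (filter P? xs) ≤ length xs
length-filter-reject₂ P? (here refl) (here refl) x≢y _ _ = ⊥-elim (x≢y refl)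
length-filter-reject₂ P? {_ ∷ xs} (here refl) (there y∈xs) _ ¬Px ¬Py
  rewrite filter-reject P? {xs = xs} ¬Px = s≤s (filter-notAll P? xs (Any.map (λ { refl → ¬Py }) y∈xs))
length-filter-reject₂ P? {_ ∷ xs} (there x∈xs) (here refl) _ ¬Px ¬Py
  rewrite filter-reject P? {xs = xs} ¬Py = s≤s (filter-notAll P? xs (Any.map (λ { refl → ¬Px }) x∈xs))
length-filter-reject₂ P? {z ∷ xs} (there x∈xs) (there y∈xs) x≢y ¬Px ¬Py with P? z
... | yes _ = s≤s (length-filter-reject₂ P? x∈xs y∈xs x≢y ¬Px ¬Py)
... | no _ = ≤-trans (length-filter-reject₂ P? x∈xs y∈xs x≢y ¬Px ¬Py) (n≤1+n _)

Universal : ∀ {n} → Graph n → Fin n → Set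
Universal G v = ∀ w → w ≢ v → Adj G v w

degree≡n⇒universal : ∀ {n} (G : Graph (suc n)) {v : Fin (suc n)} → degree G v ≡ n → Universal G v
degree≡n⇒universal {n} G {v} deg w w≢v with adj? G v w
... | yes v~w = v~w
... | no v≁w = ⊥-elim (1+n≰n (subst (λ d → 2 + d ≤ suc n) deg bound))
  where
  bound : 2 + degree G v ≤ suc n
  bound = subst (2 + degree G v ≤_) (length-tabulate {n = suc n} (λ i → i))
            (length-filter-reject₂ (adj? G v) (∈-allFin v) (∈-allFin w)
              (λ v≡w → w≢v (≡-sym v≡w)) (irrefl G) v≁w)

fromℕ-or-inject₁ : ∀ {k} (i : Fin (suc k)) → i ≡ fromℕ k ⊎ Σ[ j ∈ Fin k ] i ≡ inject₁ j
fromℕ-or-inject₁ {zero} zero = inj₁ refl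
fromℕ-or-inject₁ {suc k} zero = inj₂ (zero , refl)
fromℕ-or-inject₁ {suc k} (suc i) with fromℕ-or-inject₁ i
... | inj₁ i≡last = inj₁ (cong suc i≡last)
... | inj₂ (j , i≡j) = inj₂ (suc j , cong suc i≡j)

second≢start : ∀ {n} {G : Graph n} {u : Fin n} {k} (C : EulerCircuit G u (suc k)) →
               seq C (suc zero) ≢ u
second≢start {G = G} C c₁≡u = irrefl G (subst₂ (Adj G) (start C) c₁≡u (walk C zero))

module UniversalVertex {n} (G : Graph n) {v : Fin n} (universal : Universal G v)
                       {k} (C D : EulerCircuit G v (suc k)) (avoiding : Avoiding C D) where

  interior≢v : ∀ i → 1 ≤ toℕ i → seq C (inject₁ i) ≢ v
  interior≢v i 1≤i cᵢ≡v with seq D (inject₁ i) ≟ v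
  ... | yes dᵢ≡v = proj₁ (avoiding i 1≤i) (trans cᵢ≡v (≡-sym dᵢ≡v))
  ... | no dᵢ≢v = proj₂ (avoiding i 1≤i) (subst (λ x → Adj G x _) (≡-sym cᵢ≡v) (universal _ dᵢ≢v))

  second-or-penultimate : ∀ w → w ≢ v → w ≡ seq C (suc zero) ⊎ w ≡ seq C (inject₁ (fromℕ k))
  second-or-penultimate w w≢v with covers C v w (universal w w≢v)
  ... | zero , inj₁ (_ , c₁≡w) = inj₁ (≡-sym c₁≡w)
  ... | suc i , inj₁ (cᵢ≡v , _) = ⊥-elim (interior≢v (suc i) (s≤s z≤n) cᵢ≡v)
  ... | i , inj₂ (cᵢ≡w , cᵢ₊₁≡v) with fromℕ-or-inject₁ i
  ...   | inj₁ refl = inj₂ (≡-sym cᵢ≡w)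
  ...   | inj₂ (j , refl) = ⊥-elim (interior≢v (suc j) (s≤s z≤n) cᵢ₊₁≡v)

no-avoiding-pair-at-universal :
  ∀ {n} (G : Graph n) {v w : Fin n} → Universal G v → w ≢ v →
  ∀ {m} (C D : EulerCircuit G v m) → ¬ Avoiding C D
no-avoiding-pair-at-universal G universal w≢v {zero} C D _
  with () ← proj₁ (covers C _ _ (universal _ w≢v))
no-avoiding-pair-at-universal G universal w≢v {1} C D _ = second≢start C (end C)
no-avoiding-pair-at-universal G universal w≢v {2} C D _
  with () ← trail C zero (suc zero) (inj₂ (trans (start C) (≡-sym (end C)) , refl))
no-avoiding-pair-at-universal {n} G universal _ {suc (suc (suc j))} C D avoiding =
  c₂-nowhere (second-or-penultimate _ (interior≢v (suc (suc zero)) (s≤s z≤n)))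
  where
  open UniversalVertex G universal C D avoiding
  c₁ c₂ d₁ last : Fin n
  c₁ = seq C (suc zero)
  c₂ = seq C (suc (suc zero))
  d₁ = seq D (suc zero)
  last = seq C (inject₁ (fromℕ (suc (suc j))))

  c₁~c₂ : Adj G c₁ c₂
  c₁~c₂ = walk C (suc zero)

  c₁≢d₁ : c₁ ≢ d₁
  c₁≢d₁ = proj₁ (avoiding (suc zero) (s≤s z≤n))

  c₁≁d₁ : ¬ Adj G c₁ d₁
  c₁≁d₁ = proj₂ (avoiding (suc zero) (s≤s z≤n))

  last≡d₁ : last ≡ d₁
  last≡d₁ with second-or-penultimate d₁ (second≢start D)
  ... | inj₁ d₁≡c₁ = ⊥-elim (c₁≢d₁ (≡-sym d₁≡c₁))
  ... | inj₂ d₁≡last = ≡-sym d₁≡last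

  c₂-nowhere : c₂ ≡ c₁ ⊎ c₂ ≡ last → ⊥
  c₂-nowhere (inj₁ c₂≡c₁) = irrefl G (subst (Adj G c₁) c₂≡c₁ c₁~c₂)
  c₂-nowhere (inj₂ c₂≡last) = c₁≁d₁ (subst (Adj G c₁) (trans c₂≡last last≡d₁) c₁~c₂)

lemma1 : (n : ℕ) → 3 ≤ n → Odd n → (G : Graph n) → Connected G →
         (v : Fin n) → degree G v ≡ n ∸ 1 → ¬ DoublyEulerian G
lemma1 (suc zero) (s≤s ()) _ _ _ _ _
lemma1 (suc (suc n)) _ _ G _ v deg (_ , doubly) with doubly v
... | _ , C , D , avoiding =
  no-avoiding-pair-at-universal G (degree≡n⇒universal G deg) (punchInᵢ≢i v zero) C D avoiding
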